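{- Let $T^\ast:\mathbb{Z}\to\{a,b,c,d\}$ be a palindrome-free Thue's sequence. If $W=(v_1,\dots,v_k,v_{k+1},\dots,v_{2k})$ is a repetitive lazy walk in $T^\ast$, then $v_i=v_{k+i}$ for all $1\le i\le k$; that is, $W$ is composed of two identical lazy walks.
   Context: A sequence $T^\ast:\mathbb{Z}\to\{a,b,c,d\}$ is a palindrome-free Thue's sequence if (i) it contains no repetition: there are no $i\in\mathbb{Z}$, $k\ge1$ with $T^\ast(i+j)=T^\ast(i+k+j)$ for all $0\le j<k$; and (ii) it contains no palindrome: there is no block $T^\ast(i),T^\ast(i+1),\dots,T^\ast(i+m)$ with $m\ge1$ which equals its reversal. The sequence is viewed as a coloring of the two-way infinite path with vertex set $\mathbb{Z}$ (where $i$ and $i+1$ are adjacent). A lazy walk in it is a sequence of integers $v_1,\dots,v_r$ with $v_{j+1}-v_j\in\{ -1,0,1\}$ for all $j$. A lazy walk $(v_1,\dots,v_{2k})$ is repetitive if $T^\ast(v_i)=T^\ast(v_{k+i})$ for all $1\le i\le k$. -}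

module Defs where

open import Data.Nat using (ℕ; suc; _<_; _≤_; _+_)
open import Data.Integer using (ℤ; +_; _-_) renaming (_+_ to _+ℤ_)
open import Data.Product using (∃; _×_; _,_)
open import Data.Sum using (_⊎_)
open import Relation.Nullary using (¬_)
open import Relation.Binary.PropositionalEquality using (_≡_)

data Letter : Set where
  a b c d : Letter

Seq : Set
Seq = ℤ → Letter

RepetitionFree : Seq → Set
RepetitionFree T =
  ¬ (∃ λ (i : ℤ) → ∃ λ (k : ℕ) → (1 ≤ k) ×
       ((j : ℕ) → j < k → T (i +ℤ + j) ≡ T (i +ℤ + k +ℤ + j)))

PalindromeFree : Seq → Set
PalindromeFree T =
  ¬ (∃ λ (i : ℤ) → ∃ λ (m : ℕ) → (1 ≤ m) ×
       ((j : ℕ) → j ≤ m → T (i +ℤ + j) ≡ T ((i +ℤ + m) - + j)))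

PalindromeFreeThue : Seq → Set
PalindromeFreeThue T = RepetitionFree T × PalindromeFree T

LazyStep : ℤ → ℤ → Set
LazyStep x y = (y ≡ x +ℤ + 1) ⊎ (y ≡ x) ⊎ (x ≡ y +ℤ + 1)

-- A lazy walk of length r, indexed 0,…,r-1 (v_{j+1} in the paper is v j here).
-- Values of v at indices ≥ r are irrelevant.
LazyWalk : ℕ → (ℕ → ℤ) → Set
LazyWalk r v = (j : ℕ) → suc j < r → LazyStep (v j) (v (suc j))

Repetitive : Seq → (k : ℕ) → (ℕ → ℤ) → Set
Repetitive T k v = (i : ℕ) → i < k → T (v i) ≡ T (v (k + i))

-- Palindrome-freeness makes the letters at x - 1, x, x + 1 pairwise distinct, so a lazy step is
-- determined by the letter it reaches. Run the halves u i = v i and w i = v (k + i) side by side: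
-- they read the same letters, and inductively w i = f (u i) for an isometry f of ℤ (a translation
-- or a reflection) such that T agrees with T ∘ f on the interval swept by u. When u enters a new
-- point, the step of w is forced to follow f, because the two other candidates carry the letters
-- of points already swept. At the end f (u 0) = v k is one lazy step away from u (k - 1), hence
-- within distance one of the swept interval; a nonzero translation would then produce a square,
-- and a reflection not fixing the interval a palindrome, so f is the identity there: u i = w i.

module Submission where

open import Defs
open import Data.Nat using (ℕ; _<_; _+_)
open import Data.Integer using (ℤ)
open import Relation.Binary.PropositionalEquality using (_≡_)

open import Data.Nat using (zero; suc; z≤n; s≤s; _≤_)
import Data.Nat.Properties as ℕₚ
open import Data.Integer using (+_; -_; _-_; +0; +[1+_]; -[1+_])
  renaming (_+_ to _+ℤ_; _≤_ to _≤ℤ_; _≤?_ to _≤ℤ?_; _≟_ to _≟ℤ_; +≤+ to +≤+ℤ)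
import Data.Integer.Properties as ℤₚ
open import Data.Integer.Tactic.RingSolver using (solve-∀)
open import Data.Empty using (⊥; ⊥-elim)
open import Data.Product using (∃; _×_; _,_)
open import Data.Sum using (_⊎_; inj₁; inj₂; map₁)
open import Function using (id; _∘_)
open import Relation.Nullary using (¬_; yes; no)
open import Relation.Binary.PropositionalEquality
  using (_≢_; refl; sym; trans; cong; subst)

_∈[_,_] : ℤ → ℤ → ℤ → Set
z ∈[ lo , hi ] = lo ≤ℤ z × z ≤ℤ hi

i≤i+1 : ∀ i → i ≤ℤ i +ℤ + 1
i≤i+1 i = ℤₚ.i≤i+j i (+ 1)

≰⇒+1≤ : ∀ {i j} → ¬ i ≤ℤ j → j +ℤ + 1 ≤ℤ i
≰⇒+1≤ {i} {j} i≰j = subst (_≤ℤ i) (ℤₚ.+-comm (+ 1) j) (ℤₚ.i<j⇒suc[i]≤j (ℤₚ.≰⇒> i≰j))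

≤∧≢⇒+1≤ : ∀ {i j} → i ≤ℤ j → i ≢ j → i +ℤ + 1 ≤ℤ j
≤∧≢⇒+1≤ {i} {j} i≤j i≢j =
  subst (_≤ℤ j) (ℤₚ.+-comm (+ 1) i) (ℤₚ.i<j⇒suc[i]≤j (ℤₚ.≤∧≢⇒< i≤j i≢j))

[i+j]-j≡i : ∀ i j → (i +ℤ j) - j ≡ i
[i+j]-j≡i = solve-∀

[i-j]+j≡i : ∀ i j → (i - j) +ℤ j ≡ i
[i-j]+j≡i = solve-∀

[i+1]+j≡[i+j]+1 : ∀ i j → (i +ℤ + 1) +ℤ j ≡ (i +ℤ j) +ℤ + 1
[i+1]+j≡[i+j]+1 = solve-∀

+-≤⇒≤- : ∀ {i j} k → i +ℤ k ≤ℤ j → i ≤ℤ j - k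
+-≤⇒≤- {i} {j} k i+k≤j = subst (_≤ℤ j - k) ([i+j]-j≡i i k) (ℤₚ.+-monoˡ-≤ (- k) i+k≤j)

+1-injective : ∀ {i j} → i +ℤ + 1 ≡ j +ℤ + 1 → i ≡ j
+1-injective {i} {j} e = trans (sym ([i+j]-j≡i i (+ 1))) (trans (cong (_- + 1) e) ([i+j]-j≡i j (+ 1)))

+1-cancel-≤ : ∀ {i j} → i +ℤ + 1 ≤ℤ j +ℤ + 1 → i ≤ℤ j
+1-cancel-≤ {i} {j} le = subst (i ≤ℤ_) ([i+j]-j≡i j (+ 1)) (+-≤⇒≤- (+ 1) le)

≤+1⇒≤⊎≡+1 : ∀ {i j} → i ≤ℤ j +ℤ + 1 → i ≤ℤ j ⊎ i ≡ j +ℤ + 1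
≤+1⇒≤⊎≡+1 {i} {j} i≤j+1 with i ≤ℤ? j
... | yes i≤j = inj₁ i≤j
... | no  i≰j = inj₂ (ℤₚ.≤-antisym i≤j+1 (≰⇒+1≤ i≰j))

≤⇒≡⊎+1≤ : ∀ {i j} → i ≤ℤ j → j ≡ i ⊎ i +ℤ + 1 ≤ℤ j
≤⇒≡⊎+1≤ {i} {j} i≤j with i ≟ℤ j
... | yes refl = inj₁ refl
... | no  i≢j  = inj₂ (≤∧≢⇒+1≤ i≤j i≢j)

∈-widen : ∀ {lo hi lo′ hi′ z} → lo′ ≤ℤ lo → hi ≤ℤ hi′ → z ∈[ lo , hi ] → z ∈[ lo′ , hi′ ]
∈-widen lo′≤lo hi≤hi′ (lo≤z , z≤hi) = ℤₚ.≤-trans lo′≤lo lo≤z , ℤₚ.≤-trans z≤hi hi≤hi′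

∈-above : ∀ {lo hi x z} → x ≡ hi +ℤ + 1 → z ∈[ lo , x ] → z ∈[ lo , hi ] ⊎ z ≡ x
∈-above refl (lo≤z , z≤x) = map₁ (lo≤z ,_) (≤+1⇒≤⊎≡+1 z≤x)

∈-below : ∀ {lo hi x z} → lo ≡ x +ℤ + 1 → z ∈[ x , hi ] → z ∈[ lo , hi ] ⊎ z ≡ x
∈-below refl (x≤z , z≤hi) with ≤⇒≡⊎+1≤ x≤z
... | inj₁ z≡x   = inj₂ z≡x
... | inj₂ x+1≤z = inj₁ (x+1≤z , z≤hi)

i+j+1≤i+k : ∀ i {j k} → j < k → (i +ℤ + j) +ℤ + 1 ≤ℤ i +ℤ + k
i+j+1≤i+k i {j} j<k = subst (_≤ℤ i +ℤ + _) (eq i (+ j)) (ℤₚ.+-monoʳ-≤ i (+≤+ℤ j<k))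
  where
  eq : ∀ x y → x +ℤ (+ 1 +ℤ y) ≡ (x +ℤ y) +ℤ + 1
  eq = solve-∀

i≡j+[i-j] : ∀ i j → i ≡ j +ℤ (i - j)
i≡j+[i-j] = solve-∀

-≡⇒≡+ : ∀ {i j d} → i - j ≡ d → i ≡ j +ℤ d
-≡⇒≡+ {i} {j} eq = trans (i≡j+[i-j] i j) (cong (j +ℤ_) eq)

≤-suc-cases : ∀ {i j} → i ≤ suc j → i ≤ j ⊎ i ≡ suc j
≤-suc-cases = map₁ ℕₚ.≤-pred ∘ ℕₚ.m≤n⇒m<n∨m≡n

lazy-sym : ∀ {x y} → LazyStep x y → LazyStep y x
lazy-sym (inj₁ e)        = inj₂ (inj₂ e)
lazy-sym (inj₂ (inj₁ e)) = inj₂ (inj₁ (sym e))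
lazy-sym (inj₂ (inj₂ e)) = inj₁ e

lazy-≤+1 : ∀ {x y} → LazyStep x y → y ≤ℤ x +ℤ + 1
lazy-≤+1 (inj₁ refl)                = ℤₚ.≤-refl
lazy-≤+1 {x} (inj₂ (inj₁ refl))     = i≤i+1 x
lazy-≤+1 {y = y} (inj₂ (inj₂ refl)) = ℤₚ.≤-trans (i≤i+1 y) (i≤i+1 (y +ℤ + 1))

lazy-near : ∀ {lo hi x y} → x ∈[ lo , hi ] → LazyStep x y →
            lo ≤ℤ y +ℤ + 1 × y ≤ℤ hi +ℤ + 1
lazy-near (lo≤x , x≤hi) step =
  ℤₚ.≤-trans lo≤x (lazy-≤+1 (lazy-sym step)) ,
  ℤₚ.≤-trans (lazy-≤+1 step) (ℤₚ.+-monoˡ-≤ (+ 1) x≤hi)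

lazy-exit : ∀ {lo hi x y} → x ∈[ lo , hi ] → LazyStep x y →
            y ∈[ lo , hi ] ⊎ (x ≡ hi × y ≡ hi +ℤ + 1) ⊎ (x ≡ lo × lo ≡ y +ℤ + 1)
lazy-exit {hi = hi} {x} (lo≤x , x≤hi) (inj₁ refl) with x ≟ℤ hi
... | yes x≡hi = inj₂ (inj₁ (x≡hi , cong (_+ℤ + 1) x≡hi))
... | no  x≢hi = inj₁ (ℤₚ.≤-trans lo≤x (i≤i+1 x) , ≤∧≢⇒+1≤ x≤hi x≢hi)
lazy-exit x∈ (inj₂ (inj₁ refl)) = inj₁ x∈
lazy-exit {lo} {y = y} (lo≤x , x≤hi) (inj₂ (inj₂ refl)) with lo ≟ℤ y +ℤ + 1
... | yes lo≡x = inj₂ (inj₂ (sym lo≡x , lo≡x))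
... | no  lo≢x = inj₁ (+1-cancel-≤ (≤∧≢⇒+1≤ lo≤x lo≢x) , ℤₚ.≤-trans (i≤i+1 y) x≤hi)

data Isometry : Set where
  translate reflect : ℤ → Isometry

⟦_⟧ : Isometry → ℤ → ℤ
⟦ translate p ⟧ x = x +ℤ p
⟦ reflect r ⟧ x = r - x

_⁻¹ : Isometry → Isometry
translate p ⁻¹ = translate (- p)
reflect r ⁻¹ = reflect r

⁻¹-inverseˡ : ∀ f x → ⟦ f ⁻¹ ⟧ (⟦ f ⟧ x) ≡ x
⁻¹-inverseˡ (translate p) x = [i+j]-j≡i x p
⁻¹-inverseˡ (reflect r) x = eq x r
  where
  eq : ∀ x r → r - (r - x) ≡ x
  eq = solve-∀

⁻¹-inverseʳ : ∀ f x → ⟦ f ⟧ (⟦ f ⁻¹ ⟧ x) ≡ x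
⁻¹-inverseʳ (translate p) x = [i-j]+j≡i x p
⁻¹-inverseʳ (reflect r) x = ⁻¹-inverseˡ (reflect r) x

k-i≡[k-[i+1]]+1 : ∀ k i → k - i ≡ (k - (i +ℤ + 1)) +ℤ + 1
k-i≡[k-[i+1]]+1 = solve-∀

⟦⟧-lazy : ∀ f {x y} → LazyStep x y → LazyStep (⟦ f ⟧ x) (⟦ f ⟧ y)
⟦⟧-lazy (translate p) {x} (inj₁ refl)            = inj₁ ([i+1]+j≡[i+j]+1 x p)
⟦⟧-lazy (translate p) (inj₂ (inj₁ refl))         = inj₂ (inj₁ refl)
⟦⟧-lazy (translate p) {y = y} (inj₂ (inj₂ refl)) = inj₂ (inj₂ ([i+1]+j≡[i+j]+1 y p))
⟦⟧-lazy (reflect r) {x} (inj₁ refl)              = inj₂ (inj₂ (k-i≡[k-[i+1]]+1 r x))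
⟦⟧-lazy (reflect r) (inj₂ (inj₁ refl))           = inj₂ (inj₁ refl)
⟦⟧-lazy (reflect r) {y = y} (inj₂ (inj₂ refl))   = inj₁ (k-i≡[k-[i+1]]+1 r y)

lazy-preimage : ∀ f {x y} → LazyStep (⟦ f ⟧ x) y → ∃ λ z → LazyStep x z × y ≡ ⟦ f ⟧ z
lazy-preimage f {x} {y} step =
  ⟦ f ⁻¹ ⟧ y ,
  subst (λ t → LazyStep t (⟦ f ⁻¹ ⟧ y)) (⁻¹-inverseˡ f x) (⟦⟧-lazy (f ⁻¹) step) ,
  sym (⁻¹-inverseʳ f y)

isometry-through : ∀ {p p′ q q′} → LazyStep p p′ → p′ ≢ p → LazyStep q q′ → q′ ≢ q →
                   ∃ λ f → ⟦ f ⟧ p ≡ q × ⟦ f ⟧ p′ ≡ q′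
isometry-through (inj₂ (inj₁ refl)) p′≢p _ _ = ⊥-elim (p′≢p refl)
isometry-through _ _ (inj₂ (inj₁ refl)) q′≢q = ⊥-elim (q′≢q refl)
isometry-through {p} {_} {q} (inj₁ refl) _ (inj₁ refl) _ =
  translate (q - p) , sym (i≡j+[i-j] q p) , eq p q
  where
  eq : ∀ p q → (p +ℤ + 1) +ℤ (q - p) ≡ q +ℤ + 1
  eq = solve-∀
isometry-through {p} {_} {_} {q′} (inj₁ refl) _ (inj₂ (inj₂ refl)) _ =
  reflect (p +ℤ (q′ +ℤ + 1)) , eq₁ p q′ , eq₂ p q′
  where
  eq₁ : ∀ p q′ → (p +ℤ (q′ +ℤ + 1)) - p ≡ q′ +ℤ + 1
  eq₁ = solve-∀
  eq₂ : ∀ p q′ → (p +ℤ (q′ +ℤ + 1)) - (p +ℤ + 1) ≡ q′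
  eq₂ = solve-∀
isometry-through {_} {p′} {q} (inj₂ (inj₂ refl)) _ (inj₁ refl) _ =
  reflect ((p′ +ℤ + 1) +ℤ q) , eq₁ p′ q , eq₂ p′ q
  where
  eq₁ : ∀ p′ q → ((p′ +ℤ + 1) +ℤ q) - (p′ +ℤ + 1) ≡ q
  eq₁ = solve-∀
  eq₂ : ∀ p′ q → ((p′ +ℤ + 1) +ℤ q) - p′ ≡ q +ℤ + 1
  eq₂ = solve-∀
isometry-through {_} {p′} {_} {q′} (inj₂ (inj₂ refl)) _ (inj₂ (inj₂ refl)) _ =
  translate (q′ - p′) , eq p′ q′ , sym (i≡j+[i-j] q′ p′)
  where
  eq : ∀ p′ q′ → (p′ +ℤ + 1) +ℤ (q′ - p′) ≡ q′ +ℤ + 1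
  eq = solve-∀

Agrees : Seq → Isometry → ℤ → ℤ → Set
Agrees T f lo hi = ∀ {z} → z ∈[ lo , hi ] → T z ≡ T (⟦ f ⟧ z)

module Rigidity {T : Seq} (pf : PalindromeFree T) where

  adjacent-distinct : ∀ x → T x ≢ T (x +ℤ + 1)
  adjacent-distinct x eq = pf (x , 1 , s≤s z≤n , mirrored)
    where
    e₀ : ∀ x → x +ℤ + 0 ≡ x
    e₀ = solve-∀
    e₁ : ∀ x → x ≡ (x +ℤ + 1) - + 1
    e₁ = solve-∀
    e₂ : ∀ x → x +ℤ + 1 ≡ (x +ℤ + 1) - + 0
    e₂ = solve-∀
    mirrored : ∀ j → j ≤ 1 → T (x +ℤ + j) ≡ T ((x +ℤ + 1) - + j)
    mirrored zero _       = trans (cong T (e₀ x)) (trans eq (cong T (e₂ x)))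
    mirrored (suc zero) _ = trans (sym eq) (cong T (e₁ x))
    mirrored (suc (suc _)) (s≤s ())

  gap-distinct : ∀ x → T x ≢ T ((x +ℤ + 1) +ℤ + 1)
  gap-distinct x eq = pf (x , 2 , s≤s z≤n , mirrored)
    where
    e₀ : ∀ x → x +ℤ + 0 ≡ x
    e₀ = solve-∀
    e₁ : ∀ x → x +ℤ + 1 ≡ (x +ℤ + 2) - + 1
    e₁ = solve-∀
    e₂ : ∀ x → (x +ℤ + 1) +ℤ + 1 ≡ (x +ℤ + 2) - + 0
    e₂ = solve-∀
    e₃ : ∀ x → (x +ℤ + 1) +ℤ + 1 ≡ x +ℤ + 2
    e₃ = solve-∀
    e₄ : ∀ x → x ≡ (x +ℤ + 2) - + 2
    e₄ = solve-∀
    mirrored : ∀ j → j ≤ 2 → T (x +ℤ + j) ≡ T ((x +ℤ + 2) - + j)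
    mirrored zero _             = trans (cong T (e₀ x)) (trans eq (cong T (e₂ x)))
    mirrored (suc zero) _       = cong T (e₁ x)
    mirrored (suc (suc zero)) _ = trans (cong T (sym (e₃ x))) (trans (sym eq) (cong T (e₄ x)))
    mirrored (suc (suc (suc _))) (s≤s (s≤s ()))

  lazy-letter-injective : ∀ {x y z} → LazyStep x y → LazyStep x z → T y ≡ T z → y ≡ z
  lazy-letter-injective (inj₁ refl) (inj₁ refl) _ = refl
  lazy-letter-injective {x} (inj₁ refl) (inj₂ (inj₁ refl)) eq = ⊥-elim (adjacent-distinct x (sym eq))
  lazy-letter-injective {z = z} (inj₁ refl) (inj₂ (inj₂ refl)) eq = ⊥-elim (gap-distinct z (sym eq))
  lazy-letter-injective {x} (inj₂ (inj₁ refl)) (inj₁ refl) eq = ⊥-elim (adjacent-distinct x eq)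
  lazy-letter-injective (inj₂ (inj₁ refl)) (inj₂ (inj₁ refl)) _ = refl
  lazy-letter-injective {z = z} (inj₂ (inj₁ refl)) (inj₂ (inj₂ refl)) eq = ⊥-elim (adjacent-distinct z (sym eq))
  lazy-letter-injective {y = y} (inj₂ (inj₂ refl)) (inj₁ refl) eq = ⊥-elim (gap-distinct y eq)
  lazy-letter-injective {y = y} (inj₂ (inj₂ refl)) (inj₂ (inj₁ refl)) eq = ⊥-elim (adjacent-distinct y eq)
  lazy-letter-injective (inj₂ (inj₂ e₁)) (inj₂ (inj₂ e₂)) _ = +1-injective (trans (sym e₁) e₂)

  image-determined : ∀ {f x x′ y} → LazyStep x x′ → LazyStep (⟦ f ⟧ x) y → T x′ ≡ T y →
                     (∀ {z} → LazyStep x z → z ≢ x′ → T z ≡ T (⟦ f ⟧ z)) → y ≡ ⟦ f ⟧ x′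
  image-determined {f} {x′ = x′} step image-step eq others with lazy-preimage f image-step
  ... | z , step′ , refl with z ≟ℤ x′
  ...   | yes refl = refl
  ...   | no  z≢x′ = ⊥-elim (z≢x′ (lazy-letter-injective step′ step (trans (others step′ z≢x′) (sym eq))))

  -- While the interval is a single point, f is only determined there; it is then replaced by the
  -- isometry through the new pair of steps.
  extend-above : ∀ {f lo hi x′ y} → Agrees T f lo hi → lo ≤ℤ hi → x′ ≡ hi +ℤ + 1 →
                 LazyStep (⟦ f ⟧ hi) y → T x′ ≡ T y →
                 ∃ λ g → (∀ {z} → z ∈[ lo , hi ] → ⟦ g ⟧ z ≡ ⟦ f ⟧ z) × y ≡ ⟦ g ⟧ x′
  extend-above {f} {lo} {hi} {y = y} agree lo≤hi refl step eq with hi ≤ℤ? lo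
  ... | no hi≰lo = f , (λ _ → refl) , image-determined {f} (inj₁ refl) step eq others
    where
    others : ∀ {z} → LazyStep hi z → z ≢ hi +ℤ + 1 → T z ≡ T (⟦ f ⟧ z)
    others (inj₁ refl) z≢ = ⊥-elim (z≢ refl)
    others (inj₂ (inj₁ refl)) _ = agree (lo≤hi , ℤₚ.≤-refl)
    others {z} (inj₂ (inj₂ hi≡z+1)) _ =
      agree (+1-cancel-≤ (subst (lo +ℤ + 1 ≤ℤ_) hi≡z+1 (≰⇒+1≤ hi≰lo)) ,
             subst (z ≤ℤ_) (sym hi≡z+1) (i≤i+1 z))
  ... | yes hi≤lo with isometry-through (inj₁ refl) (adjacent-distinct hi ∘ cong T ∘ sym) step y≢fhi
    where
    y≢fhi : y ≢ ⟦ f ⟧ hi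
    y≢fhi refl = adjacent-distinct hi (trans (agree (lo≤hi , ℤₚ.≤-refl)) (sym eq))
  ...   | g , g-hi , g-next = g , on-point , sym g-next
    where
    on-point : ∀ {z} → z ∈[ lo , hi ] → ⟦ g ⟧ z ≡ ⟦ f ⟧ z
    on-point (lo≤z , z≤hi) rewrite ℤₚ.≤-antisym z≤hi (ℤₚ.≤-trans hi≤lo lo≤z) = g-hi

  extend-below : ∀ {f lo hi x′ y} → Agrees T f lo hi → lo ≤ℤ hi → lo ≡ x′ +ℤ + 1 →
                 LazyStep (⟦ f ⟧ lo) y → T x′ ≡ T y →
                 ∃ λ g → (∀ {z} → z ∈[ lo , hi ] → ⟦ g ⟧ z ≡ ⟦ f ⟧ z) × y ≡ ⟦ g ⟧ x′
  extend-below {f} {lo} {hi} {x′} {y} agree lo≤hi refl step eq with hi ≤ℤ? lo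
  ... | no hi≰lo = f , (λ _ → refl) , image-determined {f} (inj₂ (inj₂ refl)) step eq others
    where
    others : ∀ {z} → LazyStep lo z → z ≢ x′ → T z ≡ T (⟦ f ⟧ z)
    others (inj₁ refl) _ = agree (i≤i+1 lo , ≰⇒+1≤ hi≰lo)
    others (inj₂ (inj₁ refl)) _ = agree (ℤₚ.≤-refl , lo≤hi)
    others (inj₂ (inj₂ lo≡z+1)) z≢ = ⊥-elim (z≢ (+1-injective (sym lo≡z+1)))
  ... | yes hi≤lo with isometry-through (inj₂ (inj₂ refl)) (adjacent-distinct x′ ∘ cong T) step y≢flo
    where
    y≢flo : y ≢ ⟦ f ⟧ lo
    y≢flo refl = adjacent-distinct x′ (trans eq (sym (agree (ℤₚ.≤-refl , lo≤hi))))
  ...   | g , g-lo , g-next = g , on-point , sym g-next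
    where
    on-point : ∀ {z} → z ∈[ lo , hi ] → ⟦ g ⟧ z ≡ ⟦ f ⟧ z
    on-point (lo≤z , z≤hi) rewrite ℤₚ.≤-antisym (ℤₚ.≤-trans z≤hi hi≤lo) lo≤z = g-lo

  ¬reflection-ahead : ∀ {r lo hi u n} → Agrees T (reflect r) lo hi → u ∈[ lo , hi ] →
                       r - u ≡ u +ℤ + suc n → r - u ≤ℤ hi +ℤ + 1 → ⊥
  ¬reflection-ahead {r} {lo} {hi} {u} {n} agree (lo≤u , u≤hi) image≡ image≤ =
    pf (u , suc n , s≤s z≤n , mirrored)
    where
    e₁ : ∀ r u j → r - (u +ℤ j) ≡ (r - u) - j
    e₁ = solve-∀
    mirrored : ∀ j → j ≤ suc n → T (u +ℤ + j) ≡ T ((u +ℤ + suc n) - + j)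
    mirrored j j≤1+n with ≤-suc-cases j≤1+n
    ... | inj₁ j≤n = trans (agree z∈) (cong T (trans (e₁ r u (+ j)) (cong (_- + j) image≡)))
      where
      z∈ : (u +ℤ + j) ∈[ lo , hi ]
      z∈ = ℤₚ.≤-trans lo≤u (ℤₚ.i≤i+j u (+ j)) ,
           +1-cancel-≤ (ℤₚ.≤-trans (i+j+1≤i+k u (s≤s j≤n)) (subst (_≤ℤ hi +ℤ + 1) image≡ image≤))
    ... | inj₂ refl = trans (cong T (sym image≡)) (trans (sym (agree (lo≤u , u≤hi))) (cong T (sym ([i+j]-j≡i u (+ suc n)))))

  ¬reflection-behind : ∀ {r lo hi u n} → Agrees T (reflect r) lo hi → u ∈[ lo , hi ] →
                        r - u ≡ u - + suc n → lo ≤ℤ (r - u) +ℤ + 1 → ⊥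
  ¬reflection-behind {r} {lo} {hi} {u} {n} agree (lo≤u , u≤hi) image≡ lo≤image =
    pf (w , suc n , s≤s z≤n , mirrored)
    where
    w : ℤ
    w = u - + suc n
    e : ∀ r y j → r - (y - j) ≡ (r - y) +ℤ j
    e = solve-∀
    top : w +ℤ + suc n ≡ u
    top = [i-j]+j≡i u (+ suc n)
    mirrored : ∀ j → j ≤ suc n → T (w +ℤ + j) ≡ T ((w +ℤ + suc n) - + j)
    mirrored j j≤1+n with ≤-suc-cases j≤1+n
    ... | inj₁ j≤n = sym (trans (agree z∈) (cong T mirror))
      where
      mirror : r - ((w +ℤ + suc n) - + j) ≡ w +ℤ + j
      mirror = trans (e r _ (+ j)) (trans (cong (λ t → (r - t) +ℤ + j) top) (cong (_+ℤ + j) image≡))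
      z∈ : ((w +ℤ + suc n) - + j) ∈[ lo , hi ]
      z∈ = ℤₚ.≤-trans (subst (λ t → lo ≤ℤ t +ℤ + 1) image≡ lo≤image)
                      (+-≤⇒≤- (+ j) (subst (_≤ℤ w +ℤ + suc n) (sym ([i+1]+j≡[i+j]+1 w (+ j))) (i+j+1≤i+k w (s≤s j≤n)))) ,
           ℤₚ.≤-trans (ℤₚ.i-j≤i _ (+ j)) (subst (_≤ℤ hi) (sym top) u≤hi)
    ... | inj₂ refl = trans (cong T top) (trans (agree (lo≤u , u≤hi)) (cong T (trans image≡ (sym ([i+j]-j≡i w (+ suc n))))))

  reflection-centred-fixes : ∀ {r lo hi u} → Agrees T (reflect r) lo hi → u ∈[ lo , hi ] → r - u ≡ u →
                       ∀ {z} → z ∈[ lo , hi ] → r - z ≡ z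
  reflection-centred-fixes {r} {lo} {hi} {u} agree (lo≤u , u≤hi) centred {z} (lo≤z , z≤hi) with hi ≤ℤ? lo
  ... | yes hi≤lo = trans (cong (λ t → r - t) z≡u) (trans centred (sym z≡u))
    where
    z≡u : z ≡ u
    z≡u = ℤₚ.≤-antisym (ℤₚ.≤-trans z≤hi (ℤₚ.≤-trans hi≤lo lo≤u))
                       (ℤₚ.≤-trans u≤hi (ℤₚ.≤-trans hi≤lo lo≤z))
  ... | no hi≰lo = ⊥-elim (gap-distinct (u - + 1) (trans u-1≈u+1 (cong T (e₀ u))))
    where
    e₀ : ∀ u → u +ℤ + 1 ≡ ((u - + 1) +ℤ + 1) +ℤ + 1
    e₀ = solve-∀
    e₁ : ∀ r u → r - (u +ℤ + 1) ≡ (r - u) - + 1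
    e₁ = solve-∀
    e₂ : ∀ r u → r - (u - + 1) ≡ (r - u) +ℤ + 1
    e₂ = solve-∀
    u-1≈u+1 : T (u - + 1) ≡ T (u +ℤ + 1)
    u-1≈u+1 with u ≟ℤ hi
    ... | no u≢hi =
      sym (trans (agree (ℤₚ.≤-trans lo≤u (i≤i+1 u) , ≤∧≢⇒+1≤ u≤hi u≢hi))
                 (cong T (trans (e₁ r u) (cong (_- + 1) centred))))
    ... | yes u≡hi =
      trans (agree (+-≤⇒≤- (+ 1) (subst (lo +ℤ + 1 ≤ℤ_) (sym u≡hi) (≰⇒+1≤ hi≰lo)) ,
                    ℤₚ.≤-trans (ℤₚ.i-j≤i u (+ 1)) u≤hi))
            (cong T (trans (e₂ r u) (cong (_+ℤ + 1) centred)))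

  translation-trivial : RepetitionFree T → ∀ {p lo hi u} → Agrees T (translate p) lo hi →
                        u ∈[ lo , hi ] → lo ≤ℤ (u +ℤ p) +ℤ + 1 → u +ℤ p ≤ℤ hi +ℤ + 1 → p ≡ +0
  translation-trivial rf {+0} _ _ _ _ = refl
  translation-trivial rf {+[1+ n ]} {lo} {hi} {u} agree (lo≤u , _) _ image≤ =
    ⊥-elim (rf (u , suc n , s≤s z≤n , repeated))
    where
    swap : ∀ u j s → (u +ℤ j) +ℤ s ≡ (u +ℤ s) +ℤ j
    swap = solve-∀
    repeated : ∀ j → j < suc n → T (u +ℤ + j) ≡ T ((u +ℤ + suc n) +ℤ + j)
    repeated j j<1+n =
      trans (agree (ℤₚ.≤-trans lo≤u (ℤₚ.i≤i+j u (+ j)) ,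
                    +1-cancel-≤ (ℤₚ.≤-trans (i+j+1≤i+k u j<1+n) image≤)))
            (cong T (swap u (+ j) (+ suc n)))
  translation-trivial rf { -[1+ n ]} {lo} {hi} {u} agree (_ , u≤hi) lo≤image _ =
    ⊥-elim (rf (start , suc n , s≤s z≤n , repeated))
    where
    w start : ℤ
    w = u - + suc n
    start = (w +ℤ + 1) - + suc n
    e₁ : ∀ w s j → (((w +ℤ + 1) - s) +ℤ s) +ℤ j ≡ (w +ℤ + 1) +ℤ j
    e₁ = solve-∀
    e₂ : ∀ w s j → ((w +ℤ + 1) +ℤ j) - s ≡ ((w +ℤ + 1) - s) +ℤ j
    e₂ = solve-∀
    repeated : ∀ j → j < suc n → T (start +ℤ + j) ≡ T ((start +ℤ + suc n) +ℤ + j)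
    repeated j j<1+n =
      sym (trans (cong T (e₁ w (+ suc n) (+ j)))
                 (trans (agree z∈) (cong T (e₂ w (+ suc n) (+ j)))))
      where
      z∈ : ((w +ℤ + 1) +ℤ + j) ∈[ lo , hi ]
      z∈ = ℤₚ.≤-trans lo≤image (ℤₚ.i≤i+j (w +ℤ + 1) (+ j)) ,
           ℤₚ.≤-trans (subst (_≤ℤ w +ℤ + suc n) (sym ([i+1]+j≡[i+j]+1 w (+ j))) (i+j+1≤i+k w j<1+n))
                      (subst (_≤ℤ hi) (sym ([i-j]+j≡i u (+ suc n))) u≤hi)

  agreement-fixes : RepetitionFree T → ∀ {f lo hi u} → Agrees T f lo hi → u ∈[ lo , hi ] →
                    lo ≤ℤ ⟦ f ⟧ u +ℤ + 1 → ⟦ f ⟧ u ≤ℤ hi +ℤ + 1 →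
                    ∀ {z} → z ∈[ lo , hi ] → ⟦ f ⟧ z ≡ z
  agreement-fixes rf {translate p} agree u∈ lo≤image image≤ {z} _ =
    trans (cong (z +ℤ_) (translation-trivial rf agree u∈ lo≤image image≤)) (ℤₚ.+-identityʳ z)
  agreement-fixes rf {reflect r} {u = u} agree u∈ lo≤image image≤ with (r - u) - u in displacement
  ... | +0       = reflection-centred-fixes {r} agree u∈ (trans (-≡⇒≡+ {r - u} displacement) (ℤₚ.+-identityʳ u))
  ... | +[1+ n ] = ⊥-elim (¬reflection-ahead {r} agree u∈ (-≡⇒≡+ {r - u} displacement) image≤)
  ... | -[1+ n ] = ⊥-elim (¬reflection-behind {r} agree u∈ (-≡⇒≡+ {r - u} displacement) lo≤image)

walk-prefix : ∀ {m r v} → LazyWalk (m + r) v → LazyWalk m v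
walk-prefix {m} walk j j<m = walk j (ℕₚ.<-≤-trans j<m (ℕₚ.m≤m+n m _))

walk-suffix : ∀ {m r v} → LazyWalk (m + r) v → LazyWalk r (λ j → v (m + j))
walk-suffix {m} {r} {v} walk j 1+j<r =
  subst (λ t → LazyStep (v (m + j)) (v t)) (sym (ℕₚ.+-suc m j))
        (walk (m + j) (subst (_< m + r) (ℕₚ.+-suc m j) (ℕₚ.+-monoʳ-< m 1+j<r)))

walk-junction : ∀ {m r v} → LazyWalk (suc m + suc r) v → LazyStep (v m) (v (suc m + 0))
walk-junction {m} {v = v} walk =
  subst (λ t → LazyStep (v m) (v t)) (sym (ℕₚ.+-identityʳ (suc m)))
        (walk m (s≤s (ℕₚ.m<m+n m (s≤s z≤n))))

module Matching {T : Seq} (pf : PalindromeFree T) {k : ℕ} {u w : ℕ → ℤ}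
                (u-walk : LazyWalk k u) (w-walk : LazyWalk k w)
                (same-letters : ∀ j → j < k → T (u j) ≡ T (w j)) where

  open Rigidity {T} pf

  record Matched (j : ℕ) : Set where
    field
      f      : Isometry
      lo hi  : ℤ
      agrees : Agrees T f lo hi
      inside : ∀ i → i ≤ j → u i ∈[ lo , hi ]
      image  : ∀ i → i ≤ j → w i ≡ ⟦ f ⟧ (u i)

  matched-start : 0 < k → Matched 0
  matched-start 0<k = record
    { f      = translate (w 0 - u 0)
    ; lo     = u 0
    ; hi     = u 0
    ; agrees = λ { (u₀≤z , z≤u₀) → subst (λ t → T t ≡ T (⟦ translate (w 0 - u 0) ⟧ t))
                                          (ℤₚ.≤-antisym u₀≤z z≤u₀)
                                          (trans (same-letters 0 0<k) (cong T w₀≡)) }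
    ; inside = λ { zero _ → ℤₚ.≤-refl , ℤₚ.≤-refl }
    ; image  = λ { zero _ → w₀≡ }
    }
    where
    w₀≡ : w 0 ≡ u 0 +ℤ (w 0 - u 0)
    w₀≡ = i≡j+[i-j] (w 0) (u 0)

  module _ {j : ℕ} (1+j<k : suc j < k) (m : Matched j) where
    open Matched m

    private
      x′ y′ : ℤ
      x′ = u (suc j)
      y′ = w (suc j)

      letters : T x′ ≡ T y′
      letters = same-letters (suc j) 1+j<k

      extend-by : (g : Isometry) {lo′ hi′ : ℤ} →
               (∀ {z} → z ∈[ lo , hi ] → ⟦ g ⟧ z ≡ ⟦ f ⟧ z) →
               (∀ {z} → z ∈[ lo , hi ] → z ∈[ lo′ , hi′ ]) →
               (∀ {z} → z ∈[ lo′ , hi′ ] → z ∈[ lo , hi ] ⊎ z ≡ x′) →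
               x′ ∈[ lo′ , hi′ ] → y′ ≡ ⟦ g ⟧ x′ → Matched (suc j)
      extend-by g {lo′} {hi′} g≗f widen covered x′∈ y′≡ = record
        { f = g ; lo = lo′ ; hi = hi′ ; agrees = agrees′ ; inside = inside′ ; image = image′ }
        where
        agrees′ : Agrees T g lo′ hi′
        agrees′ z∈ with covered z∈
        ... | inj₁ z∈old = trans (agrees z∈old) (cong T (sym (g≗f z∈old)))
        ... | inj₂ refl  = trans letters (cong T y′≡)
        inside′ : ∀ i → i ≤ suc j → u i ∈[ lo′ , hi′ ]
        inside′ i i≤1+j with ≤-suc-cases i≤1+j
        ... | inj₁ i≤j = widen (inside i i≤j)
        ... | inj₂ refl = x′∈
        image′ : ∀ i → i ≤ suc j → w i ≡ ⟦ g ⟧ (u i)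
        image′ i i≤1+j with ≤-suc-cases i≤1+j
        ... | inj₁ i≤j = trans (image i i≤j) (sym (g≗f (inside i i≤j)))
        ... | inj₂ refl = y′≡

      step : LazyStep (⟦ f ⟧ (u j)) y′
      step = subst (λ t → LazyStep t y′) (image j ℕₚ.≤-refl) (w-walk j 1+j<k)

      lo≤hi : lo ≤ℤ hi
      lo≤hi = let (lo≤x , x≤hi) = inside j ℕₚ.≤-refl in ℤₚ.≤-trans lo≤x x≤hi

    matched-step : Matched (suc j)
    matched-step with lazy-exit (inside j ℕₚ.≤-refl) (u-walk j 1+j<k)
    ... | inj₁ x′∈ =
      extend-by f (λ _ → refl) id inj₁ x′∈
             (lazy-letter-injective step (⟦⟧-lazy f (u-walk j 1+j<k)) (trans (sym letters) (agrees x′∈)))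
    ... | inj₂ (inj₁ (x≡hi , x′≡hi+1))
      with extend-above {f} agrees lo≤hi x′≡hi+1 (subst (λ t → LazyStep (⟦ f ⟧ t) y′) x≡hi step) letters
    ...   | g , g≗f , y′≡ =
      extend-by g g≗f (∈-widen ℤₚ.≤-refl hi≤x′) (∈-above x′≡hi+1) (ℤₚ.≤-trans lo≤hi hi≤x′ , ℤₚ.≤-refl) y′≡
      where
      hi≤x′ : hi ≤ℤ x′
      hi≤x′ = subst (hi ≤ℤ_) (sym x′≡hi+1) (i≤i+1 hi)
    matched-step | inj₂ (inj₂ (x≡lo , lo≡x′+1))
      with extend-below {f} agrees lo≤hi lo≡x′+1 (subst (λ t → LazyStep (⟦ f ⟧ t) y′) x≡lo step) letters
    ...   | g , g≗f , y′≡ =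
      extend-by g g≗f (∈-widen x′≤lo ℤₚ.≤-refl) (∈-below lo≡x′+1) (ℤₚ.≤-refl , ℤₚ.≤-trans x′≤lo lo≤hi) y′≡
      where
      x′≤lo : x′ ≤ℤ lo
      x′≤lo = subst (x′ ≤ℤ_) (sym lo≡x′+1) (i≤i+1 x′)

  matched : ∀ j → j < k → Matched j
  matched zero    0<k   = matched-start 0<k
  matched (suc j) 1+j<k = matched-step 1+j<k (matched j (ℕₚ.<-trans (ℕₚ.n<1+n j) 1+j<k))

theorem1 : (T : Seq) → PalindromeFreeThue T →
    (k : ℕ) (v : ℕ → ℤ) → LazyWalk (k + k) v → Repetitive T k v →
    (i : ℕ) → i < k → v i ≡ v (k + i)
theorem1 T _ zero _ _ _ _ ()
theorem1 T (rf , pf) (suc n) v walk repetitive i (s≤s i≤n) =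
  sym (trans (image i i≤n) (f-fixes (inside i i≤n)))
  where
  open Matching {T} pf (walk-prefix {suc n} walk) (walk-suffix {suc n} walk) repetitive
  open Matched (matched n ℕₚ.≤-refl)
  junction : LazyStep (v n) (⟦ f ⟧ (v 0))
  junction = subst (LazyStep (v n)) (image 0 z≤n) (walk-junction walk)
  f-fixes : ∀ {z} → z ∈[ lo , hi ] → ⟦ f ⟧ z ≡ z
  f-fixes = let (lo≤fu , fu≤hi) = lazy-near (inside n ℕₚ.≤-refl) junction
            in Rigidity.agreement-fixes {T} pf rf {f} agrees (inside 0 z≤n) lo≤fu fu≤hi
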